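{- Let $n\ge 1$ and $k\ge 1$. The number of occurrences of the subsequence $1^k$ in $C_n$ (i.e. the number of $k$-element sets of positions of $C_n$ all carrying the letter $1$) is $\binom{2^{n-1}}{k}$, and the number of occurrences of the subsequence $2^k$ in $C_n$ is $\binom{2^{n-1}-1}{k}$. Consequently the number of occurrences of the pattern $1^k=1\text{ - }1\text{ - }\cdots\text{ - }1$ ($k$ letters) in $C_n$ is $$c_n^{1^k}=\binom{2^{n-1}}{k}+\binom{2^{n-1}-1}{k},$$ which equals $\frac{2^n-k}{2^{n-1}-k}\binom{2^{n-1}-1}{k}$ whenever $k\neq 2^{n-1}$.
   Context: The sigma-words are the words over $\{1,2\}$ defined by $C_1=1$, $D_1=2$, $C_{k+1}=C_k1D_k$, $D_{k+1}=C_k2D_k$ for $k\ge1$. The reduced form of a word $u$ over positive integers is obtained by replacing each letter by its rank among the distinct letters occurring in $u$ (smallest letter becomes $1$, next becomes $2$, etc.). An occurrence of the (classical) pattern $1\text{ - }1\text{ - }\cdots\text{ - }1$ ($k$ letters) in a word $w=w_1\cdots w_N$ is a choice of indices $i_1<\cdots<i_k$ such that $w_{i_1}\cdots w_{i_k}$ has reduced form $11\cdots1$, i.e. all chosen letters are equal. $c_n^{\tau}$ denotes the number of occurrences of the pattern $\tau$ in $C_n$. -}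

module Defs where

open import Data.Nat using (ℕ; zero; suc; _≡ᵇ_)
open import Data.Bool using (Bool; true; false; if_then_else_)
open import Data.Product using (_×_; _,_; proj₁)
open import Data.List using (List; []; _∷_; _++_; [_]; map; length; filter)
open import Data.List.Relation.Unary.All using (All)
open import Relation.Binary.PropositionalEquality using (_≡_)

Word : Set
Word = List ℕ

-- sigma-words, shifted index: CD m = (C_{m+1} , D_{m+1}), where
-- C_1 = 1, D_1 = 2, C_{k+1} = C_k 1 D_k, D_{k+1} = C_k 2 D_k.
CD : ℕ → Word × Word
CD zero = [ 1 ] , [ 2 ]
CD (suc m) with CD m
... | c , d = c ++ (1 ∷ d) , c ++ (2 ∷ d)

-- sigmaC n for n ≥ 1 is the sigma-word C_n (sigmaC 0 is a dummy, never used).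
sigmaC : ℕ → Word
sigmaC zero = []
sigmaC (suc m) = proj₁ (CD m)

-- All choices of k positions i₁ < … < i_k in a word, each choice
-- recorded as the subsequence w_{i₁} … w_{i_k} of chosen letters
-- (one list entry per choice of index set, so multiplicities are kept).
subseqs : ℕ → Word → List Word
subseqs zero    w       = [ [] ]
subseqs (suc k) []      = []
subseqs (suc k) (x ∷ w) = map (x ∷_) (subseqs k w) ++ subseqs (suc k) w

AllEq : ℕ → Word → Bool
AllEq a []      = true
AllEq a (x ∷ u) = if x ≡ᵇ a then AllEq a u else false

-- Reduced form has shape 1 1 … 1, i.e. all letters are equal.
isConst : Word → Bool
isConst []      = true
isConst (x ∷ u) = AllEq x u

countTrue : {A : Set} → (A → Bool) → List A → ℕ
countTrue p []       = 0
countTrue p (x ∷ xs) = if p x then suc (countTrue p xs) else countTrue p xs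

occLetter : ℕ → ℕ → Word → ℕ
occLetter a k w = countTrue (AllEq a) (subseqs k w)

occPattern1k : ℕ → Word → ℕ
occPattern1k k w = countTrue isConst (subseqs k w)

-- A choice of k positions all carrying the letter a is a k-subset of the occurrences of a, so
-- by Pascal's rule occLetter a k w is (number of a's in w) C k; in a word over {1,2} a constant
-- subsequence is constant 1 or constant 2. Induction on the pair (C_n, D_n), whose letter counts
-- are swapped, shows that C_n has 2^(n-1) ones and 2^(n-1) - 1 twos. With denominators cleared,
-- the last identity reduces to N (N C k) = k (N C k) + N ((N - 1) C k), which follows from the
-- absorption identity k (N C k) = N ((N - 1) C (k - 1)) and Pascal's rule.
module Submission where

open import Defs
open import Data.Nat using (ℕ; _+_; _*_; _∸_; _^_; _≥_)
open import Data.Nat.Combinatorics using (_C_)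
open import Data.Product using (_×_)
open import Relation.Binary.PropositionalEquality using (_≡_; _≢_)
open import Data.Integer using (ℤ; +_) renaming (_*_ to _*ℤ_; _-_ to _-ℤ_)

open import Data.Bool using (Bool; true; false; if_then_else_)
open import Data.Integer using (-_) renaming (_+_ to _+ℤ_)
open import Data.Integer.Properties using (pos-+; pos-*)
import Data.Integer.Properties as ℤ
open import Data.List using ([]; _∷_; _++_; map)
open import Data.List.Relation.Unary.All using (All; []; _∷_)
open import Data.List.Relation.Unary.All.Properties using (++⁺)
open import Data.Nat using (zero; suc; _≡ᵇ_)
open import Data.Nat.Combinatorics using (nCk+nC[k+1]≡[n+1]C[k+1]; nC1≡n)
open import Data.Nat.Properties
  using (+-assoc; +-suc; +-identityʳ; *-identityʳ; *-zeroʳ; *-distribˡ-+; +-commutativeSemigroup)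
open import Data.Product using (_,_; proj₁; proj₂)
open import Data.Sum using (_⊎_; inj₁; inj₂)
open import Function using (_∘_)
open import Relation.Binary.PropositionalEquality using (refl; sym; trans; cong; cong₂; module ≡-Reasoning)

open import Algebra.Properties.AbelianGroup ℤ.+-0-abelianGroup using (xyx⁻¹≈y)
open import Algebra.Properties.CommutativeSemigroup +-commutativeSemigroup using (x∙yz≈y∙xz)
open ≡-Reasoning

countTrue-++ : ∀ {A : Set} (p : A → Bool) xs ys →
               countTrue p (xs ++ ys) ≡ countTrue p xs + countTrue p ys
countTrue-++ p []       ys = refl
countTrue-++ p (x ∷ xs) ys with p x
... | true  = cong suc (countTrue-++ p xs ys)
... | false = countTrue-++ p xs ys

countTrue-map : ∀ {A B : Set} (p : B → Bool) (f : A → B) xs →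
                countTrue p (map f xs) ≡ countTrue (p ∘ f) xs
countTrue-map p f []       = refl
countTrue-map p f (x ∷ xs) with p (f x)
... | true  = cong suc (countTrue-map p f xs)
... | false = countTrue-map p f xs

countTrue-guard : ∀ {A : Set} (p : A → Bool) b xs →
                  countTrue (λ x → if b then p x else false) xs ≡ (if b then countTrue p xs else 0)
countTrue-guard p true  xs       = refl
countTrue-guard p false []       = refl
countTrue-guard p false (x ∷ xs) = countTrue-guard p false xs

count : ℕ → Word → ℕ
count a = countTrue (_≡ᵇ a)

occLetter-∷ : ∀ a k x w →
              occLetter a (suc k) (x ∷ w) ≡ (if x ≡ᵇ a then occLetter a k w else 0) + occLetter a (suc k) w
occLetter-∷ a k x w = begin
    countTrue (AllEq a) (map (x ∷_) (subseqs k w) ++ subseqs (suc k) w)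
  ≡⟨ countTrue-++ (AllEq a) (map (x ∷_) (subseqs k w)) (subseqs (suc k) w) ⟩
    countTrue (AllEq a) (map (x ∷_) (subseqs k w)) + occLetter a (suc k) w
  ≡⟨ cong (_+ occLetter a (suc k) w) (countTrue-map (AllEq a) (x ∷_) (subseqs k w)) ⟩
    countTrue (AllEq a ∘ (x ∷_)) (subseqs k w) + occLetter a (suc k) w
  ≡⟨ cong (_+ occLetter a (suc k) w) (countTrue-guard (AllEq a) (x ≡ᵇ a) (subseqs k w)) ⟩
    (if x ≡ᵇ a then occLetter a k w else 0) + occLetter a (suc k) w ∎

occLetter≡countCk : ∀ a k w → occLetter a k w ≡ count a w C k
occLetter≡countCk a zero    w       = refl
occLetter≡countCk a (suc k) []      = refl
occLetter≡countCk a (suc k) (x ∷ w) rewrite occLetter-∷ a k x w with x ≡ᵇ a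
... | true  = trans (cong₂ _+_ (occLetter≡countCk a k w) (occLetter≡countCk a (suc k) w))
                    (nCk+nC[k+1]≡[n+1]C[k+1] (count a w) k)
... | false = occLetter≡countCk a (suc k) w

occPattern1k-∷ : ∀ k x w → occPattern1k (suc k) (x ∷ w) ≡ occLetter x k w + occPattern1k (suc k) w
occPattern1k-∷ k x w =
  trans (countTrue-++ isConst (map (x ∷_) (subseqs k w)) (subseqs (suc k) w))
        (cong (_+ occPattern1k (suc k) w) (countTrue-map isConst (x ∷_) (subseqs k w)))

Over12 : Word → Set
Over12 = All (λ x → x ≡ 1 ⊎ x ≡ 2)

occPattern1k≡occLetter1+occLetter2 : ∀ k w → Over12 w →
  occPattern1k (suc k) w ≡ occLetter 1 (suc k) w + occLetter 2 (suc k) w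
occPattern1k≡occLetter1+occLetter2 k []      []           = refl
occPattern1k≡occLetter1+occLetter2 k (x ∷ w) (x∈12 ∷ w∈12)
  rewrite occPattern1k-∷ k x w | occLetter-∷ 1 k x w | occLetter-∷ 2 k x w
        | occPattern1k≡occLetter1+occLetter2 k w w∈12
  with x∈12
... | inj₁ refl = sym (+-assoc (occLetter 1 k w) _ _)
... | inj₂ refl = x∙yz≈y∙xz (occLetter 2 k w) (occLetter 1 (suc k) w) (occLetter 2 (suc k) w)

CD-over12 : ∀ m → Over12 (proj₁ (CD m)) × Over12 (proj₂ (CD m))
CD-over12 zero    = inj₁ refl ∷ [] , inj₂ refl ∷ []
CD-over12 (suc m) with CD-over12 m
... | c∈12 , d∈12 = ++⁺ c∈12 (inj₁ refl ∷ d∈12) , ++⁺ c∈12 (inj₂ refl ∷ d∈12)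

record LetterCounts (N : ℕ) (c d : Word) : Set where
  field
    ones-c : count 1 c ≡ N
    twos-c : suc (count 2 c) ≡ N
    ones-d : suc (count 1 d) ≡ N
    twos-d : count 2 d ≡ N

letterCounts-step : ∀ {N c d} → LetterCounts N c d →
                    LetterCounts (N + N) (c ++ 1 ∷ d) (c ++ 2 ∷ d)
letterCounts-step {N} {c} {d} cnt = record
  { ones-c = trans (countTrue-++ (_≡ᵇ 1) c (1 ∷ d)) (cong₂ _+_ ones-c ones-d)
  ; twos-c = trans (cong suc (countTrue-++ (_≡ᵇ 2) c (1 ∷ d))) (cong₂ _+_ twos-c twos-d)
  ; ones-d = trans (cong suc (countTrue-++ (_≡ᵇ 1) c (2 ∷ d)))
                   (trans (sym (+-suc (count 1 c) (count 1 d))) (cong₂ _+_ ones-c ones-d))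
  ; twos-d = trans (countTrue-++ (_≡ᵇ 2) c (2 ∷ d))
                   (trans (+-suc (count 2 c) (count 2 d)) (cong₂ _+_ twos-c twos-d))
  }
  where open LetterCounts cnt

CD-letterCounts : ∀ m → LetterCounts (2 ^ m) (proj₁ (CD m)) (proj₂ (CD m))
CD-letterCounts zero    = record { ones-c = refl ; twos-c = refl ; ones-d = refl ; twos-d = refl }
CD-letterCounts (suc m) rewrite +-identityʳ (2 ^ m) = letterCounts-step (CD-letterCounts m)

[1+k]*[1+n]C[1+k]≡[1+n]*nCk : ∀ n k → suc k * (suc n C suc k) ≡ suc n * (n C k)
[1+k]*[1+n]C[1+k]≡[1+n]*nCk n       zero    =
  trans (+-identityʳ (suc n C 1)) (trans (nC1≡n (suc n)) (sym (*-identityʳ (suc n))))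
[1+k]*[1+n]C[1+k]≡[1+n]*nCk zero    (suc k) = *-zeroʳ (suc (suc k))
[1+k]*[1+n]C[1+k]≡[1+n]*nCk (suc n) (suc k) = begin
    (2 + k) * ((2 + n) C (2 + k))
  ≡⟨ cong ((2 + k) *_) (nCk+nC[k+1]≡[n+1]C[k+1] (suc n) (suc k)) ⟨
    (2 + k) * (a + b)
  ≡⟨ *-distribˡ-+ (2 + k) a b ⟩
    a + (1 + k) * a + (2 + k) * b
  ≡⟨ cong₂ (λ x y → a + x + y) ([1+k]*[1+n]C[1+k]≡[1+n]*nCk n k)
                                ([1+k]*[1+n]C[1+k]≡[1+n]*nCk n (suc k)) ⟩
    a + (1 + n) * c + (1 + n) * d
  ≡⟨ +-assoc a ((1 + n) * c) ((1 + n) * d) ⟩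
    a + ((1 + n) * c + (1 + n) * d)
  ≡⟨ cong (λ x → a + x) (*-distribˡ-+ (1 + n) c d) ⟨
    a + (1 + n) * (c + d)
  ≡⟨ cong (λ x → a + (1 + n) * x) (nCk+nC[k+1]≡[n+1]C[k+1] n k) ⟩
    (2 + n) * a ∎
  where
  a b c d : ℕ
  a = suc n C suc k
  b = suc n C suc (suc k)
  c = n C k
  d = n C suc k

n*nCk≡k*nCk+n*[n∸1]Ck : ∀ n k → n * (n C k) ≡ k * (n C k) + n * ((n ∸ 1) C k)
n*nCk≡k*nCk+n*[n∸1]Ck zero    zero    = refl
n*nCk≡k*nCk+n*[n∸1]Ck zero    (suc k) = sym (trans (+-identityʳ (suc k * 0)) (*-zeroʳ (suc k)))
n*nCk≡k*nCk+n*[n∸1]Ck (suc n) zero    = refl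
n*nCk≡k*nCk+n*[n∸1]Ck (suc n) (suc k) = begin
    suc n * (suc n C suc k)
  ≡⟨ cong (suc n *_) (nCk+nC[k+1]≡[n+1]C[k+1] n k) ⟨
    suc n * (n C k + n C suc k)
  ≡⟨ *-distribˡ-+ (suc n) (n C k) (n C suc k) ⟩
    suc n * (n C k) + suc n * (n C suc k)
  ≡⟨ cong (_+ suc n * (n C suc k)) ([1+k]*[1+n]C[1+k]≡[1+n]*nCk n k) ⟨
    suc k * (suc n C suc k) + suc n * (n C suc k) ∎

[n-k]*[x+y]≡[2n-k]*y : ∀ (n k x y : ℤ) → n *ℤ x ≡ k *ℤ x +ℤ n *ℤ y →
                       (n -ℤ k) *ℤ (x +ℤ y) ≡ (n +ℤ n -ℤ k) *ℤ y
[n-k]*[x+y]≡[2n-k]*y n k x y nx≡kx+ny = begin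
    (n -ℤ k) *ℤ (x +ℤ y)
  ≡⟨ ℤ.*-distribˡ-+ (n -ℤ k) x y ⟩
    (n -ℤ k) *ℤ x +ℤ (n -ℤ k) *ℤ y
  ≡⟨ cong (λ z → z +ℤ (n -ℤ k) *ℤ y) [n-k]x≡ny ⟩
    n *ℤ y +ℤ (n -ℤ k) *ℤ y
  ≡⟨ ℤ.*-distribʳ-+ y n (n -ℤ k) ⟨
    (n +ℤ (n -ℤ k)) *ℤ y
  ≡⟨ cong (_*ℤ y) (ℤ.+-assoc n n (- k)) ⟨
    (n +ℤ n -ℤ k) *ℤ y ∎
  where
  [n-k]x≡ny : (n -ℤ k) *ℤ x ≡ n *ℤ y
  [n-k]x≡ny = begin
      (n -ℤ k) *ℤ x                 ≡⟨ ℤ.*-distribʳ-+ x n (- k) ⟩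
      n *ℤ x +ℤ (- k) *ℤ x          ≡⟨ cong₂ _+ℤ_ nx≡kx+ny (sym (ℤ.neg-distribˡ-* k x)) ⟩
      k *ℤ x +ℤ n *ℤ y -ℤ k *ℤ x    ≡⟨ xyx⁻¹≈y (k *ℤ x) (n *ℤ y) ⟩
      n *ℤ y                        ∎

[n-k]*[nCk+[n∸1]Ck]≡[2n-k]*[n∸1]Ck : ∀ n k →
  (+ n -ℤ + k) *ℤ + (n C k + (n ∸ 1) C k) ≡ (+ (2 * n) -ℤ + k) *ℤ + ((n ∸ 1) C k)
[n-k]*[nCk+[n∸1]Ck]≡[2n-k]*[n∸1]Ck n k = begin
    (+ n -ℤ + k) *ℤ + (x + y)
  ≡⟨ cong ((+ n -ℤ + k) *ℤ_) (pos-+ x y) ⟩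
    (+ n -ℤ + k) *ℤ (+ x +ℤ + y)
  ≡⟨ [n-k]*[x+y]≡[2n-k]*y (+ n) (+ k) (+ x) (+ y) nx≡kx+ny ⟩
    (+ n +ℤ + n -ℤ + k) *ℤ + y
  ≡⟨ cong (λ z → (z -ℤ + k) *ℤ + y) 2n≡n+n ⟨
    (+ (2 * n) -ℤ + k) *ℤ + y ∎
  where
  2n≡n+n : + (2 * n) ≡ + n +ℤ + n
  2n≡n+n = trans (cong (λ z → + (n + z)) (+-identityʳ n)) (pos-+ n n)
  x y : ℕ
  x = n C k
  y = (n ∸ 1) C k
  nx≡kx+ny : + n *ℤ + x ≡ + k *ℤ + x +ℤ + n *ℤ + y
  nx≡kx+ny = begin
      + n *ℤ + x                 ≡⟨ pos-* n x ⟨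
      + (n * x)                  ≡⟨ cong +_ (n*nCk≡k*nCk+n*[n∸1]Ck n k) ⟩
      + (k * x + n * y)          ≡⟨ pos-+ (k * x) (n * y) ⟩
      + (k * x) +ℤ + (n * y)     ≡⟨ cong₂ _+ℤ_ (pos-* k x) (pos-* n y) ⟩
      + k *ℤ + x +ℤ + n *ℤ + y   ∎

proposition2 : (n k : ℕ) → n ≥ 1 → k ≥ 1 →
    (occLetter 1 k (sigmaC n) ≡ (2 ^ (n ∸ 1)) C k)
    × (occLetter 2 k (sigmaC n) ≡ (2 ^ (n ∸ 1) ∸ 1) C k)
    × (occPattern1k k (sigmaC n) ≡ (2 ^ (n ∸ 1)) C k + (2 ^ (n ∸ 1) ∸ 1) C k)
    × (k ≢ 2 ^ (n ∸ 1) →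
        (+ (2 ^ (n ∸ 1)) -ℤ + k) *ℤ + occPattern1k k (sigmaC n)
          ≡ (+ (2 ^ n) -ℤ + k) *ℤ + ((2 ^ (n ∸ 1) ∸ 1) C k))
-- With denominators cleared the identity holds for every k.
proposition2 (suc m) (suc k) _ _ = ones , twos , constants , λ _ → ratio
  where
  N : ℕ
  N = 2 ^ m
  c : Word
  c = proj₁ (CD m)
  open LetterCounts (CD-letterCounts m)

  ones : occLetter 1 (suc k) c ≡ N C suc k
  ones = trans (occLetter≡countCk 1 (suc k) c) (cong (_C suc k) ones-c)

  twos : occLetter 2 (suc k) c ≡ (N ∸ 1) C suc k
  twos = trans (occLetter≡countCk 2 (suc k) c) (cong (λ z → (z ∸ 1) C suc k) twos-c)

  constants : occPattern1k (suc k) c ≡ N C suc k + (N ∸ 1) C suc k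
  constants = trans (occPattern1k≡occLetter1+occLetter2 k c (proj₁ (CD-over12 m))) (cong₂ _+_ ones twos)

  ratio : (+ N -ℤ + suc k) *ℤ + occPattern1k (suc k) c ≡ (+ (2 * N) -ℤ + suc k) *ℤ + ((N ∸ 1) C suc k)
  ratio = trans (cong (λ z → (+ N -ℤ + suc k) *ℤ + z) constants) ([n-k]*[nCk+[n∸1]Ck]≡[2n-k]*[n∸1]Ck N (suc k))
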